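{- Every bounded distributive lattice has CBLP.
   Context: Bounded distributive lattices are considered as algebras $(L,\vee,\wedge,0,1)$; they are congruence-distributive. For a congruence-distributive algebra $\mathcal{A}$ with congruence lattice ${\rm Con}(\mathcal{A})$ and $\theta\in{\rm Con}(\mathcal{A})$, let $u_\theta:{\rm Con}(\mathcal{A})\to{\rm Con}(\mathcal{A}/\theta)$, $u_\theta(\alpha)=(\alpha\vee\theta)/\theta$, where $\phi/\theta=\{(a/\theta,b/\theta)\mid(a,b)\in\phi\}$. With $\mathcal{B}(M)$ denoting the Boolean center (complemented elements) of a bounded distributive lattice $M$, $u_\theta$ maps $\mathcal{B}({\rm Con}(\mathcal{A}))$ into $\mathcal{B}({\rm Con}(\mathcal{A}/\theta))$; $\theta$ has the Congruence Boolean Lifting Property (CBLP) iff this restricted map is surjective, and $\mathcal{A}$ has CBLP iff all its congruences have CBLP. -}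

module Defs where

open import Level using (Level; _⊔_; suc)
open import Algebra.Core using (Op₂)
open import Algebra.Definitions using (Identity)
open import Algebra.Lattice.Structures using (IsDistributiveLattice)
open import Relation.Binary.Core using (Rel; _⇒_)
open import Relation.Binary.Structures using (IsEquivalence)
open import Data.Product using (Σ; _×_; ∃)

record BoundedDistributiveLattice c ℓ : Set (suc (c ⊔ ℓ)) where
  infixr 7 _∧_
  infixr 6 _∨_
  infix  4 _≈_
  field
    Carrier               : Set c
    _≈_                   : Rel Carrier ℓ
    _∨_                   : Op₂ Carrier
    _∧_                   : Op₂ Carrier
    ⊥                     : Carrier
    ⊤                     : Carrier
    isDistributiveLattice : IsDistributiveLattice _≈_ _∨_ _∧_
    ⊥-identity-∨          : Identity _≈_ ⊥ _∨_
    ⊤-identity-∧          : Identity _≈_ ⊤ _∧_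

-- Congruences of an algebra (A, ∨, ∧, 0, 1) whose equality is E.
-- (Constants are respected automatically by reflexivity.)
-- Congruences of the quotient A/θ are exactly the congruences over E := θ
-- on the same carrier (quotients are modelled as setoids with a coarser equality).
module _ {c} {A : Set c} (_∨_ _∧_ : Op₂ A) where

  record IsCongruence {ℓ r} (E : Rel A ℓ) (θ : Rel A r) : Set (c ⊔ ℓ ⊔ r) where
    field
      contains-eq : E ⇒ θ
      isEquivalence : IsEquivalence θ
      ∨-cong : ∀ {x y u v} → θ x y → θ u v → θ (x ∨ u) (y ∨ v)
      ∧-cong : ∀ {x y u v} → θ x y → θ u v → θ (x ∧ u) (y ∧ v)

data Join {c r} {A : Set c} (α β : Rel A r) : Rel A (c ⊔ r) where
  inl  : ∀ {x y} → α x y → Join α β x y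
  inr  : ∀ {x y} → β x y → Join α β x y
  step : ∀ {x y z} → Join α β x y → Join α β y z → Join α β x z

module _ {c} {A : Set c} (_∨_ _∧_ : Op₂ A) where

  -- α is a complemented element (Boolean center) of the congruence lattice of
  -- the algebra with equality E: there is a congruence β with α ∧ β = Δ (= E)
  -- and α ∨ β = ∇ (all pairs).
  IsComplementedCon : ∀ {ℓ r} (E : Rel A ℓ) (α : Rel A r) → Set (c ⊔ ℓ ⊔ suc r)
  IsComplementedCon {r = r} E α =
    Σ (Rel A r) λ β → IsCongruence _∨_ _∧_ E β
      × (∀ x y → α x y → β x y → E x y)
      × (∀ x y → Join α β x y)

  -- θ (a congruence over E) has CBLP: every complemented congruence of A/θ
  -- is u_θ(α) = (α ∨ θ)/θ for some complemented congruence α of A.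
  HasCBLP-at : ∀ {ℓ r} (E : Rel A ℓ) (θ : Rel A r) → Set (c ⊔ ℓ ⊔ suc r)
  HasCBLP-at {r = r} E θ =
    (β : Rel A r) → IsCongruence _∨_ _∧_ θ β → IsComplementedCon θ β →
    Σ (Rel A r) λ α → IsCongruence _∨_ _∧_ E α × IsComplementedCon E α
      × (∀ x y → (Join α θ x y → β x y) × (β x y → Join α θ x y))

HasCBLP : ∀ {c ℓ} → BoundedDistributiveLattice c ℓ → Set (suc (c ⊔ ℓ))
HasCBLP {c} {ℓ} L = (θ : Rel Carrier (c ⊔ ℓ)) → IsCongruence _∨_ _∧_ _≈_ θ →
  HasCBLP-at _∨_ _∧_ _≈_ θ
  where open BoundedDistributiveLattice L

-- Let θ be a congruence of L and β ⊇ θ a congruence whose class β/θ is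
-- complemented in Con(L/θ), with complement γ/θ: β ∩ γ ⊆ θ and β ∨ γ = ∇.
-- Since (⊥, ⊤) ∈ β ∨ γ, partial joins of a zigzag from ⊥ to ⊤ give a chain
-- ⊥ = a₀ ≤ a₁ ≤ … ≤ aₙ ≈ ⊤ whose steps (aᵢ, aᵢ₊₁) lie in β or in γ.
-- Every interval [a, d] carries the retraction x ↦ (x ∨ a) ∧ d, whose kernel is
-- a congruence of L. Let α be the intersection of these kernels over the γ-steps
-- of the chain and δ the intersection over the β-steps. Because the steps cover
-- the whole chain, α ∩ δ = Δ and α ∨ δ = ∇, so α is complemented in Con(L);
-- and α ∨ θ = β: α collapses exactly the β-steps, while on a γ-step β agrees
-- with θ because β ∩ γ ⊆ θ.

module Submission where

open import Defs
open import Level using (_⊔_; Lift; lift; lower)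
open import Data.Unit.Polymorphic.Base using () renaming (⊤ to Unit; tt to tt)
open import Data.Product using (_×_; _,_; proj₁; proj₂)
open import Relation.Binary.Core using (Rel; _⇒_)
open import Relation.Binary.Structures using (IsEquivalence)
open import Relation.Binary.Lattice using (JoinSemilattice)
open import Algebra.Lattice.Bundles using (DistributiveLattice)
import Algebra.Lattice.Properties.DistributiveLattice as DistributiveLatticeProperties
import Relation.Binary.Reasoning.Setoid as SetoidReasoning

module Development {c ℓ} (L : BoundedDistributiveLattice c ℓ) where
  open BoundedDistributiveLattice L

  distributiveLattice : DistributiveLattice c ℓ
  distributiveLattice = record { isDistributiveLattice = isDistributiveLattice }

  open DistributiveLattice distributiveLattice
    using ( isEquivalence; setoid; ∨-comm; ∨-assoc; ∧-comm; ∧-assoc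
          ; ∨-absorbs-∧; ∧-absorbs-∨; ∨-distribʳ-∧; ∧-distribˡ-∨; ∧-distribʳ-∨
          ; ∨-congˡ; ∨-congʳ; ∧-congˡ; ∧-congʳ )
    renaming (∨-cong to ∨-cong≈; ∧-cong to ∧-cong≈)
  open DistributiveLatticeProperties distributiveLattice
    using (∨-idem; ∨-orderTheoreticJoinSemilattice)
  open IsEquivalence isEquivalence using () renaming (refl to ≈-refl; sym to ≈-sym; trans to ≈-trans)
  open SetoidReasoning setoid

  -- The lattice order: a ≤ d means d ≈ d ∨ a.
  open JoinSemilattice ∨-orderTheoreticJoinSemilattice
    using (_≤_; x≤x∨y; y≤x∨y) renaming (refl to ≤-refl; trans to ≤-trans)

  ≤⇒∨≈ : ∀ {a d} → a ≤ d → d ∨ a ≈ d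
  ≤⇒∨≈ = ≈-sym

  ≤⇒∧≈ : ∀ {a d} → a ≤ d → d ∧ a ≈ a
  ≤⇒∧≈ {a} {d} a≤d = begin
    d ∧ a        ≈⟨ ∧-congʳ a≤d ⟩
    (d ∨ a) ∧ a  ≈⟨ ∧-comm (d ∨ a) a ⟩
    a ∧ (d ∨ a)  ≈⟨ ∧-congˡ (∨-comm d a) ⟩
    a ∧ (a ∨ d)  ≈⟨ ∧-absorbs-∨ a d ⟩
    a            ∎

  ⊤-absorbs-∨ : ∀ x → ⊤ ∨ x ≈ ⊤
  ⊤-absorbs-∨ x = ≈-trans (∨-congˡ (≈-sym (proj₁ ⊤-identity-∧ x))) (∨-absorbs-∧ ⊤ x)

  ⊤-maximal : ∀ {a} → ⊤ ≤ a → a ≈ ⊤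
  ⊤-maximal {a} ⊤≤a = ≈-trans ⊤≤a (≈-trans (∨-comm a ⊤) (⊤-absorbs-∨ a))

  ∧-⊥ : ∀ x → x ∧ ⊥ ≈ ⊥
  ∧-⊥ x = ≈-trans (∧-comm x ⊥) (≈-trans (∧-congˡ (≈-sym (proj₁ ⊥-identity-∨ x))) (∧-absorbs-∨ ⊥ x))

  meet-⊥ : ∀ x y → x ∧ ⊥ ≈ y ∧ ⊥
  meet-⊥ x y = ≈-trans (∧-⊥ x) (≈-sym (∧-⊥ y))

  ∨-swap : ∀ x u a → (x ∨ u) ∨ a ≈ (x ∨ a) ∨ u
  ∨-swap x u a = ≈-trans (∨-assoc x u a) (≈-trans (∨-congˡ (∨-comm u a)) (≈-sym (∨-assoc x a u)))

  ∧-absorbs-∨ʳ : ∀ x d → (x ∨ d) ∧ d ≈ d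
  ∧-absorbs-∨ʳ x d = ≈-trans (∧-comm (x ∨ d) d) (≈-trans (∧-congˡ (∨-comm x d)) (∧-absorbs-∨ d x))

  ∨-absorbs-∧ʳ : ∀ x d → (x ∧ d) ∨ d ≈ d
  ∨-absorbs-∧ʳ x d = ≈-trans (∨-comm (x ∧ d) d) (≈-trans (∨-congˡ (∧-comm x d)) (∨-absorbs-∧ d x))

  clamp : Carrier → Carrier → Carrier → Carrier
  clamp a d x = (x ∨ a) ∧ d

  clamp-below : ∀ {a u} d → u ≤ a → clamp a d u ≈ a ∧ d
  clamp-below {a} {u} d u≤a = ∧-congʳ (≈-trans (∨-comm u a) (≤⇒∨≈ u≤a))

  clamp-above : ∀ {a d} → a ≤ d → ∀ x → clamp a d (x ∨ d) ≈ d
  clamp-above {a} {d} a≤d x = begin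
    ((x ∨ d) ∨ a) ∧ d  ≈⟨ ∧-congʳ (∨-assoc x d a) ⟩
    (x ∨ (d ∨ a)) ∧ d  ≈⟨ ∧-congʳ (∨-congˡ (≤⇒∨≈ a≤d)) ⟩
    (x ∨ d) ∧ d        ≈⟨ ∧-absorbs-∨ʳ x d ⟩
    d                  ∎

  clamp-modular : ∀ {a d} → a ≤ d → ∀ x → (x ∧ d) ∨ a ≈ clamp a d x
  clamp-modular {a} {d} a≤d x = ≈-trans (∨-distribʳ-∧ a x d) (∧-congˡ (≤⇒∨≈ a≤d))

  ∧-below : ∀ {a d} → a ≤ d → ∀ x → (x ∧ d) ∧ a ≈ x ∧ a
  ∧-below {a} {d} a≤d x = ≈-trans (∧-assoc x d a) (∧-congˡ (≤⇒∧≈ a≤d))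

  IsCon : ∀ {k} → Rel Carrier k → Set (c ⊔ ℓ ⊔ k)
  IsCon K = IsCongruence _∨_ _∧_ _≈_ K

  isCon-fromRight : ∀ {k} {K : Rel Carrier k} → IsEquivalence K → _≈_ ⇒ K →
    (∀ {x y u} → K x y → K (x ∨ u) (y ∨ u)) →
    (∀ {x y u} → K x y → K (x ∧ u) (y ∧ u)) → IsCon K
  isCon-fromRight K-equiv ≈⇒K ∨-right ∧-right = record
    { contains-eq   = ≈⇒K
    ; isEquivalence = K-equiv
    ; ∨-cong        = λ {x} {y} {u} {v} p q →
        trans (∨-right p) (trans (≈⇒K (∨-comm y u)) (trans (∨-right q) (≈⇒K (∨-comm v y))))
    ; ∧-cong        = λ {x} {y} {u} {v} p q →
        trans (∧-right p) (trans (≈⇒K (∧-comm y u)) (trans (∧-right q) (≈⇒K (∧-comm v y))))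
    }
    where open IsEquivalence K-equiv

  ≈-isCon : IsCon _≈_
  ≈-isCon = record { contains-eq = λ e → e ; isEquivalence = isEquivalence
                   ; ∨-cong = ∨-cong≈ ; ∧-cong = ∧-cong≈ }

  isCon-fromQuotient : ∀ {k m} {θ : Rel Carrier k} {β : Rel Carrier m} →
    IsCon θ → IsCongruence _∨_ _∧_ θ β → IsCon β
  isCon-fromQuotient θ-con β-con = record
    { contains-eq   = λ e → β.contains-eq (θ.contains-eq e)
    ; isEquivalence = β.isEquivalence
    ; ∨-cong        = β.∨-cong
    ; ∧-cong        = β.∧-cong
    }
    where module θ = IsCongruence θ-con
          module β = IsCongruence β-con

  module Con {k} {K : Rel Carrier k} (K-con : IsCon K) where
    open IsCongruence K-con public using (contains-eq; ∨-cong; ∧-cong)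
    open IsEquivalence (IsCongruence.isEquivalence K-con) public
      renaming (refl to K-refl; sym to K-sym; trans to K-trans)

    infixr 5 _≈∙_ _∙_
    _≈∙_ : ∀ {x y z} → x ≈ y → K y z → K x z
    e ≈∙ p = K-trans (contains-eq e) p

    _∙_ : ∀ {x y z} → K x y → K y z → K x z
    _∙_ = K-trans

    cancel : ∀ {x y d} → K (x ∧ d) (y ∧ d) → K (x ∨ d) (y ∨ d) → K x y
    cancel {x} {y} {d} meet join =
      ≈-sym (∧-absorbs-∨ x d) ≈∙ ∧-cong K-refl join ∙
      ∧-distribˡ-∨ x y d ≈∙ ∨-cong K-refl meet ∙
      regroup ≈∙ ∧-cong K-refl join ∙ contains-eq (∧-absorbs-∨ y d)
      where
        regroup : (x ∧ y) ∨ (y ∧ d) ≈ y ∧ (x ∨ d)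
        regroup = ≈-sym (≈-trans (∧-distribˡ-∨ y x d) (∨-congʳ (∧-comm y x)))

    extend-meet : ∀ {a d x y} → a ≤ d → K (x ∧ a) (y ∧ a) →
      K (clamp a d x) (clamp a d y) → K (x ∧ d) (y ∧ d)
    extend-meet {a} {d} {x} {y} a≤d below on =
      cancel (∧-below a≤d x ≈∙ below ∙ contains-eq (≈-sym (∧-below a≤d y)))
             (clamp-modular a≤d x ≈∙ on ∙ contains-eq (≈-sym (clamp-modular a≤d y)))

    transfer-meet : ∀ {a d x y} → K a d → K (x ∧ a) (y ∧ a) → K (x ∧ d) (y ∧ d)
    transfer-meet a~d below = ∧-cong K-refl (K-sym a~d) ∙ below ∙ ∧-cong K-refl a~d

    meet-top : ∀ {a x y} → a ≈ ⊤ → K (x ∧ a) (y ∧ a) → K x y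
    meet-top {a} {x} {y} a≈⊤ below =
      ≈-sym (unit x) ≈∙ below ∙ contains-eq (unit y)
      where
        unit : ∀ z → z ∧ a ≈ z
        unit z = ≈-trans (∧-congˡ a≈⊤) (proj₂ ⊤-identity-∧ z)

    total : K ⊥ ⊤ → ∀ x y → K x y
    total ⊥~⊤ x y = toTop x ∙ K-sym (toTop y)
      where
        toTop : ∀ z → K z ⊤
        toTop z = ≈-sym (proj₂ ⊥-identity-∨ z) ≈∙ ∨-cong K-refl ⊥~⊤ ∙
                  contains-eq (≈-trans (∨-comm z ⊤) (⊤-absorbs-∨ z))

  -- Joining with a fixed element is a lattice endomorphism, so it pulls congruences back.
  ∨-pullback-isCon : ∀ {k} {K : Rel Carrier k} (d : Carrier) → IsCon K →
    IsCon (λ x y → K (x ∨ d) (y ∨ d))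
  ∨-pullback-isCon d K-con = isCon-fromRight
    (record { refl = K-refl ; sym = K-sym ; trans = K-trans })
    (λ e → contains-eq (∨-congʳ e))
    (λ {x} {y} {u} p → ∨-swap x u d ≈∙ ∨-cong p K-refl ∙ contains-eq (≈-sym (∨-swap y u d)))
    (λ {x} {y} {u} p → ∨-distribʳ-∧ d x u ≈∙ ∧-cong p K-refl ∙
                        contains-eq (≈-sym (∨-distribʳ-∧ d y u)))
    where open Con K-con

  total-isCon : ∀ {k} → IsCon {k} (λ _ _ → Unit)
  total-isCon = record
    { contains-eq   = λ _ → tt
    ; isEquivalence = record { refl = tt ; sym = λ _ → tt ; trans = λ _ _ → tt }
    ; ∨-cong        = λ _ _ → tt
    ; ∧-cong        = λ _ _ → tt
    }

  ∩-isCon : ∀ {k m} {P : Rel Carrier k} {Q : Rel Carrier m} → IsCon P → IsCon Q →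
    IsCon (λ x y → P x y × Q x y)
  ∩-isCon P-con Q-con = record
    { contains-eq   = λ e → P.contains-eq e , Q.contains-eq e
    ; isEquivalence = record
        { refl  = P.K-refl , Q.K-refl
        ; sym   = λ (p , q) → P.K-sym p , Q.K-sym q
        ; trans = λ (p , q) (p′ , q′) → P.K-trans p p′ , Q.K-trans q q′ }
    ; ∨-cong        = λ (p , q) (p′ , q′) → P.∨-cong p p′ , Q.∨-cong q q′
    ; ∧-cong        = λ (p , q) (p′ , q′) → P.∧-cong p p′ , Q.∧-cong q q′
    }
    where module P = Con P-con
          module Q = Con Q-con

  Lift-isCon : ∀ {k} m {P : Rel Carrier k} → IsCon P → IsCon (λ x y → Lift m (P x y))
  Lift-isCon m P-con = record
    { contains-eq   = λ e → lift (P.contains-eq e)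
    ; isEquivalence = record
        { refl  = lift P.K-refl
        ; sym   = λ p → lift (P.K-sym (lower p))
        ; trans = λ p q → lift (P.K-trans (lower p) (lower q)) }
    ; ∨-cong        = λ p q → lift (P.∨-cong (lower p) (lower q))
    ; ∧-cong        = λ p q → lift (P.∧-cong (lower p) (lower q))
    }
    where module P = Con P-con

  Join-map : ∀ {k m} {P Q : Rel Carrier k} {P′ Q′ : Rel Carrier m} (f : Carrier → Carrier) →
    (∀ {x y} → P x y → P′ (f x) (f y)) → (∀ {x y} → Q x y → Q′ (f x) (f y)) →
    ∀ {x y} → Join P Q x y → Join P′ Q′ (f x) (f y)
  Join-map f onP onQ (inl p)    = inl (onP p)
  Join-map f onP onQ (inr q)    = inr (onQ q)
  Join-map f onP onQ (step p q) = step (Join-map f onP onQ p) (Join-map f onP onQ q)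

  Join-least : ∀ {k m} {P Q : Rel Carrier k} {K : Rel Carrier m} → IsCon K →
    (∀ {x y} → P x y → K x y) → (∀ {x y} → Q x y → K x y) →
    ∀ {x y} → Join P Q x y → K x y
  Join-least K-con P⊆K Q⊆K (inl p)    = P⊆K p
  Join-least K-con P⊆K Q⊆K (inr q)    = Q⊆K q
  Join-least K-con P⊆K Q⊆K (step p q) =
    Con.K-trans K-con (Join-least K-con P⊆K Q⊆K p) (Join-least K-con P⊆K Q⊆K q)

  Join-isCon : ∀ {k} {P Q : Rel Carrier k} → IsCon P → IsCon Q → IsCon (Join P Q)
  Join-isCon {P = P} {Q} P-con Q-con = isCon-fromRight
    (record { refl = inl P.K-refl ; sym = Join-sym ; trans = step })
    (λ e → inl (P.contains-eq e))
    (Join-map _ (λ p → P.∨-cong p P.K-refl) (λ q → Q.∨-cong q Q.K-refl))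
    (Join-map _ (λ p → P.∧-cong p P.K-refl) (λ q → Q.∧-cong q Q.K-refl))
    where
      module P = Con P-con
      module Q = Con Q-con
      Join-sym : ∀ {x y} → Join P Q x y → Join P Q y x
      Join-sym (inl p)    = inl (P.K-sym p)
      Join-sym (inr q)    = inr (Q.K-sym q)
      Join-sym (step p q) = step (Join-sym q) (Join-sym p)

  Interval : Carrier → Carrier → Rel Carrier ℓ
  Interval a d x y = clamp a d x ≈ clamp a d y

  Interval-isCon : ∀ a d → IsCon (Interval a d)
  Interval-isCon a d = isCon-fromRight
    (record { refl = ≈-refl ; sym = ≈-sym ; trans = ≈-trans })
    (λ e → ∧-congʳ (∨-congʳ e)) ∨-right ∧-right
    where
      ∨-right : ∀ {x y u} → Interval a d x y → Interval a d (x ∨ u) (y ∨ u)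
      ∨-right {x} {y} {u} p = begin
        ((x ∨ u) ∨ a) ∧ d        ≈⟨ ∧-congʳ (∨-swap x u a) ⟩
        ((x ∨ a) ∨ u) ∧ d        ≈⟨ ∧-distribʳ-∨ d (x ∨ a) u ⟩
        clamp a d x ∨ (u ∧ d)    ≈⟨ ∨-congʳ p ⟩
        clamp a d y ∨ (u ∧ d)    ≈⟨ ∧-distribʳ-∨ d (y ∨ a) u ⟨
        ((y ∨ a) ∨ u) ∧ d        ≈⟨ ∧-congʳ (∨-swap y u a) ⟨
        ((y ∨ u) ∨ a) ∧ d        ∎
      ∧-right : ∀ {x y u} → Interval a d x y → Interval a d (x ∧ u) (y ∧ u)
      ∧-right {x} {y} {u} p = begin
        ((x ∧ u) ∨ a) ∧ d          ≈⟨ ∧-congʳ (∨-distribʳ-∧ a x u) ⟩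
        ((x ∨ a) ∧ (u ∨ a)) ∧ d    ≈⟨ ∧-swap (x ∨ a) ⟩
        clamp a d x ∧ (u ∨ a)      ≈⟨ ∧-congʳ p ⟩
        clamp a d y ∧ (u ∨ a)      ≈⟨ ∧-swap (y ∨ a) ⟨
        ((y ∨ a) ∧ (u ∨ a)) ∧ d    ≈⟨ ∧-congʳ (∨-distribʳ-∧ a y u) ⟨
        ((y ∧ u) ∨ a) ∧ d          ∎
        where
          ∧-swap : ∀ z → (z ∧ (u ∨ a)) ∧ d ≈ (z ∧ d) ∧ (u ∨ a)
          ∧-swap z = ≈-trans (∧-assoc z (u ∨ a) d)
                       (≈-trans (∧-congˡ (∧-comm (u ∨ a) d)) (≈-sym (∧-assoc z d (u ∨ a))))

  data Chain {k} (P Q : Rel Carrier k) : Carrier → Set (c ⊔ ℓ ⊔ k) where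
    reached : ∀ {a} → a ≈ ⊤ → Chain P Q a
    viaP    : ∀ {a} d → a ≤ d → P a d → Chain P Q d → Chain P Q a
    viaQ    : ∀ {a} d → a ≤ d → Q a d → Chain P Q d → Chain P Q a

  swap : ∀ {k} {P Q : Rel Carrier k} {a} → Chain P Q a → Chain Q P a
  swap (reached a≈⊤)      = reached a≈⊤
  swap (viaP d a≤d p ch)  = viaQ d a≤d p (swap ch)
  swap (viaQ d a≤d q ch)  = viaP d a≤d q (swap ch)

  -- Partial joins turn a zigzag in P ∨ Q into a chain. In continuation style:
  -- a zigzag from x to y, started at an upper bound a of x, becomes a monotone
  -- path from a to an upper bound a′ ≥ a of y, which `rest` continues to ⊤.
  zigzag⇒chain : ∀ {k} {P Q : Rel Carrier k} → IsCon P → IsCon Q →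
    ∀ {x y} → Join P Q x y → ∀ a → x ≤ a →
    (∀ a′ → y ≤ a′ → a ≤ a′ → Chain P Q a′) → Chain P Q a
  zigzag⇒chain P-con Q-con {y = y} (inl p) a x≤a rest =
    viaP (a ∨ y) (x≤x∨y a y) (x≤a P.≈∙ P.∨-cong P.K-refl p)
      (rest (a ∨ y) (y≤x∨y a y) (x≤x∨y a y))
    where module P = Con P-con
  zigzag⇒chain P-con Q-con {y = y} (inr q) a x≤a rest =
    viaQ (a ∨ y) (x≤x∨y a y) (x≤a Q.≈∙ Q.∨-cong Q.K-refl q)
      (rest (a ∨ y) (y≤x∨y a y) (x≤x∨y a y))
    where module Q = Con Q-con
  zigzag⇒chain P-con Q-con (step p q) a x≤a rest =
    zigzag⇒chain P-con Q-con p a x≤a λ a′ y≤a′ a≤a′ →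
      zigzag⇒chain P-con Q-con q a′ y≤a′ λ a″ z≤a″ a′≤a″ → rest a″ z≤a″ (≤-trans a≤a′ a′≤a″)

  ⊥⊤⇒chain : ∀ {k} {P Q : Rel Carrier k} → IsCon P → IsCon Q → Join P Q ⊥ ⊤ → Chain P Q ⊥
  ⊥⊤⇒chain P-con Q-con ⊥~⊤ = zigzag⇒chain P-con Q-con ⊥~⊤ ⊥ (≤-refl {⊥})
    λ a′ ⊤≤a′ _ → reached (⊤-maximal ⊤≤a′)

  -- Agreement on the Q-steps of a chain: the intersection of the interval
  -- congruences of its Q-steps. Applied to `swap ch` it concerns the P-steps.
  AgreeOnQ : ∀ {k} {P Q : Rel Carrier k} {a} → Chain P Q a → Rel Carrier ℓ
  AgreeOnQ (reached _)         x y = Unit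
  AgreeOnQ (viaP d _ _ ch)     x y = AgreeOnQ ch x y
  AgreeOnQ (viaQ {a} d _ _ ch) x y = Interval a d x y × AgreeOnQ ch x y

  module _ {k} {P Q : Rel Carrier k} where

    AgreeOnQ-isCon : ∀ {a} (ch : Chain P Q a) → IsCon (AgreeOnQ ch)
    AgreeOnQ-isCon (reached _)         = total-isCon
    AgreeOnQ-isCon (viaP d _ _ ch)     = AgreeOnQ-isCon ch
    AgreeOnQ-isCon (viaQ {a} d _ _ ch) = ∩-isCon (Interval-isCon a d) (AgreeOnQ-isCon ch)

    -- All steps of a chain starting at a lie above a, so elements below a agree.
    AgreeOnQ-below : ∀ {a} (ch : Chain P Q a) {u v} → u ≤ a → v ≤ a → AgreeOnQ ch u v
    AgreeOnQ-below (reached _) u≤a v≤a = tt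
    AgreeOnQ-below (viaP d a≤d _ ch) u≤a v≤a =
      AgreeOnQ-below ch (≤-trans u≤a a≤d) (≤-trans v≤a a≤d)
    AgreeOnQ-below (viaQ d a≤d _ ch) u≤a v≤a =
      ≈-trans (clamp-below d u≤a) (≈-sym (clamp-below d v≤a)) ,
      AgreeOnQ-below ch (≤-trans u≤a a≤d) (≤-trans v≤a a≤d)

    -- Agreement after the first step d gives agreement of x ∨ d and y ∨ d on the
    -- whole chain, since both are clamped to d on the first step.
    AgreeOnQ-raiseP : ∀ {a d} (a≤d : a ≤ d) (p : P a d) (ch : Chain P Q d) {x y} →
      AgreeOnQ ch x y → AgreeOnQ (viaP d a≤d p ch) (x ∨ d) (y ∨ d)
    AgreeOnQ-raiseP a≤d p ch agree =
      Con.∨-cong (AgreeOnQ-isCon ch) agree (Con.K-refl (AgreeOnQ-isCon ch))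

    AgreeOnQ-raiseQ : ∀ {a d} (a≤d : a ≤ d) (q : Q a d) (ch : Chain P Q d) {x y} →
      AgreeOnQ ch x y → AgreeOnQ (viaQ d a≤d q ch) (x ∨ d) (y ∨ d)
    AgreeOnQ-raiseQ a≤d q ch {x} {y} agree =
      ≈-trans (clamp-above a≤d x) (≈-sym (clamp-above a≤d y)) ,
      Con.∨-cong (AgreeOnQ-isCon ch) agree (Con.K-refl (AgreeOnQ-isCon ch))

  -- Together the two agreement congruences of a chain connect its start a to ⊤:
  -- each step is collapsed by the congruence that ignores it.
  AgreeOnQ-cover : ∀ {k} {P Q : Rel Carrier k} {a} (ch : Chain P Q a) →
    Join (AgreeOnQ ch) (AgreeOnQ (swap ch)) a ⊤
  AgreeOnQ-cover (reached _) = inl tt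
  AgreeOnQ-cover ch′@(viaP d a≤d p ch) =
    inl (AgreeOnQ-below ch a≤d (≤-refl {d})) J.∙ ≈-sym (∨-idem d) J.≈∙
    Join-map (_∨ d) (AgreeOnQ-raiseP a≤d p ch) (AgreeOnQ-raiseQ a≤d p (swap ch))
      (AgreeOnQ-cover ch) J.∙
    J.contains-eq (⊤-absorbs-∨ d)
    where module J = Con (Join-isCon (AgreeOnQ-isCon ch′) (AgreeOnQ-isCon (swap ch′)))
  AgreeOnQ-cover ch′@(viaQ d a≤d q ch) =
    inr (AgreeOnQ-below (swap ch) a≤d (≤-refl {d})) J.∙ ≈-sym (∨-idem d) J.≈∙
    Join-map (_∨ d) (AgreeOnQ-raiseQ a≤d q ch) (AgreeOnQ-raiseP a≤d q (swap ch))
      (AgreeOnQ-cover ch) J.∙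
    J.contains-eq (⊤-absorbs-∨ d)
    where module J = Con (Join-isCon (AgreeOnQ-isCon ch′) (AgreeOnQ-isCon (swap ch′)))

  AgreeOnQ-separate : ∀ {k} {P Q : Rel Carrier k} {a} (ch : Chain P Q a) {x y} →
    x ∧ a ≈ y ∧ a → AgreeOnQ ch x y → AgreeOnQ (swap ch) x y → x ≈ y
  AgreeOnQ-separate (reached a≈⊤) below _ _ = Con.meet-top ≈-isCon a≈⊤ below
  AgreeOnQ-separate (viaP d a≤d _ ch) below onQ (onP , onP′) =
    AgreeOnQ-separate ch (Con.extend-meet ≈-isCon a≤d below onP) onQ onP′
  AgreeOnQ-separate (viaQ d a≤d _ ch) below (onQ , onQ′) onP =
    AgreeOnQ-separate ch (Con.extend-meet ≈-isCon a≤d below onQ) onQ′ onP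

  module Lifting {θ β γ : Rel Carrier (c ⊔ ℓ)}
                 (θ-con : IsCon θ) (β-con : IsCon β) (γ-con : IsCon γ)
                 (β∩γ⊆θ : ∀ {x y} → β x y → γ x y → θ x y) where

    private
      module β = Con β-con
      module γ = Con γ-con
      module θ = Con θ-con

    -- Agreement on the γ-steps implies β-equivalence, since β collapses the β-steps.
    AgreeOnQ⊆β : ∀ {a} (ch : Chain β γ a) {x y} →
      β (x ∧ a) (y ∧ a) → AgreeOnQ ch x y → β x y
    AgreeOnQ⊆β (reached a≈⊤) below _ = β.meet-top a≈⊤ below
    AgreeOnQ⊆β (viaP d _ a~d ch) below agree = AgreeOnQ⊆β ch (β.transfer-meet a~d below) agree
    AgreeOnQ⊆β (viaQ d a≤d _ ch) below (on , agree) =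
      AgreeOnQ⊆β ch (β.extend-meet a≤d below (β.contains-eq on)) agree

    -- On a γ-step [a, d], β-equivalent elements have θ-equivalent clamps: the clamps
    -- are β-equivalent, and both are γ-equivalent to d because a γ d.
    clamp-θ : ∀ {a d} → γ a d → ∀ {x y} → β x y → θ (clamp a d x) (clamp a d y)
    clamp-θ {a} {d} a~d {x} {y} x~y =
      β∩γ⊆θ (β.∧-cong (β.∨-cong x~y β.K-refl) β.K-refl) (toTop x γ.∙ γ.K-sym (toTop y))
      where
        toTop : ∀ z → γ (clamp a d z) d
        toTop z = γ.∧-cong (γ.∨-cong γ.K-refl a~d) γ.K-refl γ.∙ γ.contains-eq (∧-absorbs-∨ʳ z d)

    β⊆AgreeOnQ∨θ : ∀ {a} (ch : Chain β γ a) {m} {K : Rel Carrier m} → IsCon K →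
      (∀ {x y} → θ x y → K x y) → (∀ {x y} → AgreeOnQ ch x y → K x y) →
      ∀ {x y} → K (x ∧ a) (y ∧ a) → β x y → K x y
    β⊆AgreeOnQ∨θ (reached a≈⊤) K-con θ⊆K agree⊆K below x~y = Con.meet-top K-con a≈⊤ below
    β⊆AgreeOnQ∨θ {a} (viaP d a≤d _ ch) {K = K} K-con θ⊆K agree⊆K below x~y =
      β⊆AgreeOnQ∨θ ch K-con θ⊆K agree⊆K (K.transfer-meet a~d below) x~y
      where
        module K = Con K-con
        a~d : K a d
        a~d = agree⊆K (AgreeOnQ-below ch a≤d (≤-refl {d}))
    β⊆AgreeOnQ∨θ (viaQ d a≤d a~d ch) {K = K} K-con θ⊆K agree⊆K {x} {y} below x~y =
      K.cancel (K.extend-meet a≤d below (θ⊆K (clamp-θ a~d x~y))) above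
      where
        module K = Con K-con
        -- Above d, recurse with the congruence K pulled back along (_∨ d).
        above : K (x ∨ d) (y ∨ d)
        above = β⊆AgreeOnQ∨θ ch (∨-pullback-isCon d K-con)
          (λ t → θ⊆K (θ.∨-cong t θ.K-refl))
          (λ agree → agree⊆K (AgreeOnQ-raiseQ a≤d a~d ch agree))
          (K.contains-eq (≈-trans (∨-absorbs-∧ʳ x d) (≈-sym (∨-absorbs-∧ʳ y d))))
          x~y

  every-congruence-has-CBLP : (θ : Rel Carrier (c ⊔ ℓ)) → IsCon θ → HasCBLP-at _∨_ _∧_ _≈_ θ
  every-congruence-has-CBLP θ θ-con β β-con/θ (γ , γ-con/θ , β∩γ⊆θ , β∨γ) =
    α , α-con , (δ , δ-con , α∩δ⊆≈ , Con.total (Join-isCon α-con δ-con) α∨δ) ,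
    λ x y → α∨θ⊆β , β⊆α∨θ
    where
      β-con : IsCon β
      β-con = isCon-fromQuotient θ-con β-con/θ
      γ-con : IsCon γ
      γ-con = isCon-fromQuotient θ-con γ-con/θ
      chain : Chain β γ ⊥
      chain = ⊥⊤⇒chain β-con γ-con (β∨γ ⊥ ⊤)
      open Lifting θ-con β-con γ-con (λ {x} {y} → β∩γ⊆θ x y)

      α δ : Rel Carrier (c ⊔ ℓ)
      α x y = Lift c (AgreeOnQ chain x y)
      δ x y = Lift c (AgreeOnQ (swap chain) x y)

      α-con : IsCon α
      α-con = Lift-isCon c (AgreeOnQ-isCon chain)
      δ-con : IsCon δ
      δ-con = Lift-isCon c (AgreeOnQ-isCon (swap chain))

      α∩δ⊆≈ : ∀ x y → α x y → δ x y → x ≈ y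
      α∩δ⊆≈ x y p q = AgreeOnQ-separate chain (meet-⊥ x y) (lower p) (lower q)

      α∨δ : Join α δ ⊥ ⊤
      α∨δ = Join-map (λ z → z) lift lift (AgreeOnQ-cover chain)

      α∨θ⊆β : ∀ {x y} → Join α θ x y → β x y
      α∨θ⊆β = Join-least β-con
        (λ p → AgreeOnQ⊆β chain (Con.contains-eq β-con (meet-⊥ _ _)) (lower p))
        (IsCongruence.contains-eq β-con/θ)

      β⊆α∨θ : ∀ {x y} → β x y → Join α θ x y
      β⊆α∨θ {x} {y} = β⊆AgreeOnQ∨θ chain (Join-isCon α-con θ-con) inr (λ p → inl (lift p))
        (inl (Con.contains-eq α-con (meet-⊥ x y)))

corollary4p18 : ∀ {c ℓ} (L : BoundedDistributiveLattice c ℓ) → HasCBLP L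
corollary4p18 L = Development.every-congruence-has-CBLP L
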